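{- Let $(T,\eta,\mu)$ be a monad on a category $\mathbb C$ such that for every object $X$ the parallel pair $\eta_{TX},T\eta_X:TX\rightrightarrows TTX$ has an equalizer $\theta_X:DX\to TX$, and let $D$ be the associated monad of thunkable morphisms. Then $D$ is idempotent if and only if for every object $X$ the morphism $T\theta_X:TDX\to TTX$ is monic. In particular, $D$ is idempotent if $T$ maps regular monomorphisms to monomorphisms.
   Context: A Kleisli morphism $f:X\rightsquigarrow Y$ of $T$ (a morphism $f^\sharp:X\to TY$, with Kleisli composition $(g\circledcirc f)^\sharp=\mu\circ Tg^\sharp\circ f^\sharp$) is thunkable iff $\eta_{TY}\circ f^\sharp=T\eta_Y\circ f^\sharp$, so thunkable morphisms $X\rightsquigarrow Y$ correspond bijectively to morphisms $X\to DY$ (via $u\mapsto \theta_Y\circ u$). Thunkable morphisms form a wide subcategory of $\mathsf{Kl}(T)$ containing the pure ones (those with $f^\sharp=\eta\circ g$), and this bijection is an adjunction between $\mathbb C$ and that subcategory; $D$ denotes the induced monad on $\mathbb C$, whose unit $e_X:X\to DX$ is the unique map with $\theta_X\circ e_X=\eta_X$. $D$ is idempotent if its multiplication $DD\Rightarrow D$ is an isomorphism. -}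

module Defs where

open import Level using (Level; _⊔_; suc)
open import Data.Product using (Σ; Σ-syntax; _×_; _,_; proj₁; proj₂)
open import Relation.Binary using (Rel; IsEquivalence)
import Relation.Binary.Reasoning.Setoid as SetoidR
open import Relation.Binary.Bundles using (Setoid)

record Category (o ℓ e : Level) : Set (suc (o ⊔ ℓ ⊔ e)) where
  infixr 9 _∘_
  infix  4 _≈_
  field
    Obj   : Set o
    Hom   : Obj → Obj → Set ℓ
    _≈_   : ∀ {A B} → Rel (Hom A B) e
    id    : ∀ {A} → Hom A A
    _∘_   : ∀ {A B C} → Hom B C → Hom A B → Hom A C
    equiv : ∀ {A B} → IsEquivalence (_≈_ {A} {B})
    ∘-resp-≈ : ∀ {A B C} {f h : Hom B C} {g i : Hom A B} →
               f ≈ h → g ≈ i → f ∘ g ≈ h ∘ i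
    assoc    : ∀ {A B C D} {f : Hom A B} {g : Hom B C} {h : Hom C D} →
               (h ∘ g) ∘ f ≈ h ∘ (g ∘ f)
    identityˡ : ∀ {A B} {f : Hom A B} → id ∘ f ≈ f
    identityʳ : ∀ {A B} {f : Hom A B} → f ∘ id ≈ f

  hom-setoid : ∀ {A B} → Setoid ℓ e
  hom-setoid {A} {B} = record { Carrier = Hom A B ; _≈_ = _≈_ ; isEquivalence = equiv }

  Mono : ∀ {A B} → Hom A B → Set (o ⊔ ℓ ⊔ e)
  Mono {A} f = ∀ {Z} (g h : Hom Z A) → f ∘ g ≈ f ∘ h → g ≈ h

  IsIso : ∀ {A B} → Hom A B → Set (ℓ ⊔ e)
  IsIso {A} {B} f = Σ[ g ∈ Hom B A ] ((g ∘ f ≈ id) × (f ∘ g ≈ id))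

  record IsEqualizer {E A B} (f g : Hom A B) (m : Hom E A) : Set (o ⊔ ℓ ⊔ e) where
    field
      equality  : f ∘ m ≈ g ∘ m
      factor    : ∀ {Z} (h : Hom Z A) → f ∘ h ≈ g ∘ h → Hom Z E
      factor-eq : ∀ {Z} (h : Hom Z A) (p : f ∘ h ≈ g ∘ h) → m ∘ factor h p ≈ h
      unique    : ∀ {Z} (h : Hom Z A) (p : f ∘ h ≈ g ∘ h) (u : Hom Z E) →
                  m ∘ u ≈ h → u ≈ factor h p

  record Equalizer {A B} (f g : Hom A B) : Set (o ⊔ ℓ ⊔ e) where
    field
      obj : Obj
      arr : Hom obj A
      isEqualizer : IsEqualizer f g arr
    open IsEqualizer isEqualizer public

  RegularMono : ∀ {E A} → Hom E A → Set (o ⊔ ℓ ⊔ e)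
  RegularMono {E} {A} m = Σ[ B ∈ Obj ] Σ[ f ∈ Hom A B ] Σ[ g ∈ Hom A B ] IsEqualizer f g m

record Monad {o ℓ e} (C : Category o ℓ e) : Set (o ⊔ ℓ ⊔ e) where
  open Category C
  field
    F₀ : Obj → Obj
    F₁ : ∀ {A B} → Hom A B → Hom (F₀ A) (F₀ B)
    F-resp-≈ : ∀ {A B} {f g : Hom A B} → f ≈ g → F₁ f ≈ F₁ g
    F-id  : ∀ {A} → F₁ (id {A}) ≈ id
    F-∘   : ∀ {A B C} {f : Hom A B} {g : Hom B C} → F₁ (g ∘ f) ≈ F₁ g ∘ F₁ f
    η : ∀ X → Hom X (F₀ X)
    μ : ∀ X → Hom (F₀ (F₀ X)) (F₀ X)
    η-natural : ∀ {A B} (f : Hom A B) → F₁ f ∘ η A ≈ η B ∘ f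
    μ-natural : ∀ {A B} (f : Hom A B) → F₁ f ∘ μ A ≈ μ B ∘ F₁ (F₁ f)
    μ-assoc   : ∀ {X} → μ X ∘ F₁ (μ X) ≈ μ X ∘ μ (F₀ X)
    μ-identityˡ : ∀ {X} → μ X ∘ F₁ (η X) ≈ id
    μ-identityʳ : ∀ {X} → μ X ∘ η (F₀ X) ≈ id

module Thunk {o ℓ e} (C : Category o ℓ e) (T : Monad C)
             (eq : ∀ X → Category.Equalizer C (Monad.η T (Monad.F₀ T X))
                                              (Monad.F₁ T (Monad.η T X))) where
  open Category C
  open Monad T
  module E X = Equalizer (eq X)

  D₀ : Obj → Obj
  D₀ X = E.obj X

  θ : ∀ X → Hom (D₀ X) (F₀ X)
  θ X = E.arr X

  private
    module Eqv {A B} = IsEquivalence (equiv {A} {B})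
    resp : ∀ {A B C} {f h : Hom B C} {g i : Hom A B} → f ≈ h → g ≈ i → f ∘ g ≈ h ∘ i
    resp = ∘-resp-≈
    reflh : ∀ {A B} {f : Hom A B} → f ≈ f
    reflh = Eqv.refl

  kleisli-thunkableˡ : ∀ {A B Cc} (f : Hom A (F₀ B)) (g : Hom B (F₀ Cc)) →
    η (F₀ B) ∘ f ≈ F₁ (η B) ∘ f →
    η (F₀ Cc) ∘ (μ Cc ∘ F₁ g ∘ f) ≈ F₁ g ∘ f
  kleisli-thunkableˡ {A} {B} {Cc} f g tf = let open SetoidR (hom-setoid {A} {F₀ (F₀ Cc)}) in begin
      η (F₀ Cc) ∘ (μ Cc ∘ F₁ g ∘ f)
    ≈⟨ Eqv.sym assoc ⟩
      (η (F₀ Cc) ∘ μ Cc) ∘ F₁ g ∘ f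
    ≈⟨ resp (Eqv.sym (η-natural (μ Cc))) reflh ⟩
      (F₁ (μ Cc) ∘ η (F₀ (F₀ Cc))) ∘ F₁ g ∘ f
    ≈⟨ assoc ⟩
      F₁ (μ Cc) ∘ η (F₀ (F₀ Cc)) ∘ F₁ g ∘ f
    ≈⟨ resp reflh (Eqv.sym assoc) ⟩
      F₁ (μ Cc) ∘ (η (F₀ (F₀ Cc)) ∘ F₁ g) ∘ f
    ≈⟨ resp reflh (resp (Eqv.sym (η-natural (F₁ g))) reflh) ⟩
      F₁ (μ Cc) ∘ (F₁ (F₁ g) ∘ η (F₀ B)) ∘ f
    ≈⟨ resp reflh assoc ⟩
      F₁ (μ Cc) ∘ F₁ (F₁ g) ∘ η (F₀ B) ∘ f
    ≈⟨ resp reflh (resp reflh tf) ⟩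
      F₁ (μ Cc) ∘ F₁ (F₁ g) ∘ F₁ (η B) ∘ f
    ≈⟨ resp reflh (Eqv.sym assoc) ⟩
      F₁ (μ Cc) ∘ (F₁ (F₁ g) ∘ F₁ (η B)) ∘ f
    ≈⟨ resp reflh (resp (Eqv.sym F-∘) reflh) ⟩
      F₁ (μ Cc) ∘ F₁ (F₁ g ∘ η B) ∘ f
    ≈⟨ Eqv.sym assoc ⟩
      (F₁ (μ Cc) ∘ F₁ (F₁ g ∘ η B)) ∘ f
    ≈⟨ resp (Eqv.sym F-∘) reflh ⟩
      F₁ (μ Cc ∘ F₁ g ∘ η B) ∘ f
    ≈⟨ resp (F-resp-≈ (resp reflh (η-natural g))) reflh ⟩
      F₁ (μ Cc ∘ η (F₀ Cc) ∘ g) ∘ f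
    ≈⟨ resp (F-resp-≈ (Eqv.sym assoc)) reflh ⟩
      F₁ ((μ Cc ∘ η (F₀ Cc)) ∘ g) ∘ f
    ≈⟨ resp (F-resp-≈ (resp μ-identityʳ reflh)) reflh ⟩
      F₁ (id ∘ g) ∘ f
    ≈⟨ resp (F-resp-≈ identityˡ) reflh ⟩
      F₁ g ∘ f
    ∎

  kleisli-thunkableʳ : ∀ {A B Cc} (f : Hom A (F₀ B)) (g : Hom B (F₀ Cc)) →
    η (F₀ Cc) ∘ g ≈ F₁ (η Cc) ∘ g →
    F₁ (η Cc) ∘ (μ Cc ∘ F₁ g ∘ f) ≈ F₁ g ∘ f
  kleisli-thunkableʳ {A} {B} {Cc} f g tg = let open SetoidR (hom-setoid {A} {F₀ (F₀ Cc)}) in begin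
      F₁ (η Cc) ∘ (μ Cc ∘ F₁ g ∘ f)
    ≈⟨ Eqv.sym assoc ⟩
      (F₁ (η Cc) ∘ μ Cc) ∘ F₁ g ∘ f
    ≈⟨ resp (μ-natural (η Cc)) reflh ⟩
      (μ (F₀ Cc) ∘ F₁ (F₁ (η Cc))) ∘ F₁ g ∘ f
    ≈⟨ assoc ⟩
      μ (F₀ Cc) ∘ F₁ (F₁ (η Cc)) ∘ F₁ g ∘ f
    ≈⟨ resp reflh (Eqv.sym assoc) ⟩
      μ (F₀ Cc) ∘ (F₁ (F₁ (η Cc)) ∘ F₁ g) ∘ f
    ≈⟨ resp reflh (resp (Eqv.sym F-∘) reflh) ⟩
      μ (F₀ Cc) ∘ F₁ (F₁ (η Cc) ∘ g) ∘ f
    ≈⟨ resp reflh (resp (F-resp-≈ (Eqv.sym tg)) reflh) ⟩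
      μ (F₀ Cc) ∘ F₁ (η (F₀ Cc) ∘ g) ∘ f
    ≈⟨ resp reflh (resp F-∘ reflh) ⟩
      μ (F₀ Cc) ∘ (F₁ (η (F₀ Cc)) ∘ F₁ g) ∘ f
    ≈⟨ resp reflh assoc ⟩
      μ (F₀ Cc) ∘ F₁ (η (F₀ Cc)) ∘ F₁ g ∘ f
    ≈⟨ Eqv.sym assoc ⟩
      (μ (F₀ Cc) ∘ F₁ (η (F₀ Cc))) ∘ F₁ g ∘ f
    ≈⟨ resp μ-identityˡ reflh ⟩
      id ∘ F₁ g ∘ f
    ≈⟨ identityˡ ⟩
      F₁ g ∘ f
    ∎

  kleisli-thunkable : ∀ {A B Cc} (f : Hom A (F₀ B)) (g : Hom B (F₀ Cc)) →
    η (F₀ B) ∘ f ≈ F₁ (η B) ∘ f →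
    η (F₀ Cc) ∘ g ≈ F₁ (η Cc) ∘ g →
    η (F₀ Cc) ∘ (μ Cc ∘ F₁ g ∘ f) ≈ F₁ (η Cc) ∘ (μ Cc ∘ F₁ g ∘ f)
  kleisli-thunkable f g tf tg =
    Eqv.trans (kleisli-thunkableˡ f g tf) (Eqv.sym (kleisli-thunkableʳ f g tg))

  -- The multiplication of D: the unique μD_X : DDX → DX with
  --   θ_X ∘ μD_X ≈ μ_X ∘ Tθ_X ∘ θ_{DX}
  -- (i.e. G ε F for the thunkable adjunction; ε_Y : DY ⇝ Y has ε♯ = θ_Y).
  μD : ∀ X → Hom (D₀ (D₀ X)) (D₀ X)
  μD X = E.factor X (μ X ∘ F₁ (θ X) ∘ θ (D₀ X))
           (kleisli-thunkable (θ (D₀ X)) (θ X) (E.equality (D₀ X)) (E.equality X))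

  Idempotent : Set (ℓ ⊔ e ⊔ o)
  Idempotent = ∀ X → IsIso (μD X)

{-# OPTIONS --safe #-}
module Submission where

-- Since μD ∘ e_D = id, D is idempotent iff e_D ∘ μD = id, iff (θ being monic) the counit
-- θ_{DX} equals the pure map η_{DX} ∘ μD_X. That equation always holds after composing with
-- Tθ_X (the Kleisli extension of a thunkable map is thunkable), so Tθ_X monic gives it. Conversely, when θ_{DX} is pure every thunkable map into TDX is pure; applied to
-- Te_X ∘ θ_X this forces Te_X ∘ θ_X = η_{DX}, making μ_{DX} ∘ TTe_X a retraction of Tθ_X.

open import Defs
open import Data.Product using (_×_; _,_)
open import Function.Base using (_∘′_)
open import Function.Bundles using (_⇔_; mk⇔; Equivalence)
open import Relation.Binary using (IsEquivalence)
import Relation.Binary.Reasoning.Setoid as SetoidReasoning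

module CategoryProperties {o ℓ e} (C : Category o ℓ e) where
  open Category C
  open module ≈ {A B} = IsEquivalence (equiv {A} {B}) public
    using () renaming (refl to ≈-refl; sym to ≈-sym; trans to ≈-trans)
  open module HomReasoning {A B} = SetoidReasoning (hom-setoid {A} {B}) public

  infixr 4 _⟩∘⟨_ refl⟩∘⟨_
  infixl 5 _⟩∘⟨refl

  _⟩∘⟨_ : ∀ {A B Z} {f h : Hom B Z} {g i : Hom A B} → f ≈ h → g ≈ i → f ∘ g ≈ h ∘ i
  _⟩∘⟨_ = ∘-resp-≈

  refl⟩∘⟨_ : ∀ {A B Z} {f : Hom B Z} {g i : Hom A B} → g ≈ i → f ∘ g ≈ f ∘ i
  refl⟩∘⟨ p = ≈-refl ⟩∘⟨ p

  _⟩∘⟨refl : ∀ {A B Z} {f h : Hom B Z} {g : Hom A B} → f ≈ h → f ∘ g ≈ h ∘ g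
  p ⟩∘⟨refl = p ⟩∘⟨ ≈-refl

  sym-assoc : ∀ {A B Z W} {f : Hom A B} {g : Hom B Z} {h : Hom Z W} →
              h ∘ (g ∘ f) ≈ (h ∘ g) ∘ f
  sym-assoc = ≈-sym assoc

  cancelˡ : ∀ {A B Z} {r : Hom B A} {s : Hom A B} {f : Hom Z A} →
            r ∘ s ≈ id → r ∘ (s ∘ f) ≈ f
  cancelˡ rs≈id = ≈-trans sym-assoc (≈-trans (rs≈id ⟩∘⟨refl) identityˡ)

  split-mono : ∀ {A B} (r : Hom B A) (m : Hom A B) → r ∘ m ≈ id → Mono m
  split-mono r m rm≈id g h mg≈mh = begin
    g           ≈⟨ cancelˡ rm≈id ⟨
    r ∘ (m ∘ g) ≈⟨ refl⟩∘⟨ mg≈mh ⟩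
    r ∘ (m ∘ h) ≈⟨ cancelˡ rm≈id ⟩
    h           ∎

  equalizer-mono : ∀ {E A B} {f g : Hom A B} {m : Hom E A} → IsEqualizer f g m → Mono m
  equalizer-mono {f = f} {g} {m} isEq u v mu≈mv =
    ≈-trans (unique (m ∘ u) fmu≈gmu u ≈-refl)
            (≈-sym (unique (m ∘ u) fmu≈gmu v (≈-sym mu≈mv)))
    where
    open IsEqualizer isEq
    fmu≈gmu : f ∘ (m ∘ u) ≈ g ∘ (m ∘ u)
    fmu≈gmu = ≈-trans sym-assoc (≈-trans (equality ⟩∘⟨refl) assoc)

  retraction-iso⇔section-inverse : ∀ {A B} {r : Hom B A} {s : Hom A B} →
                                   r ∘ s ≈ id → (IsIso r ⇔ (s ∘ r ≈ id))
  retraction-iso⇔section-inverse {r = r} {s} rs≈id = mk⇔ section-inverse (λ sr≈id → s , sr≈id , rs≈id)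
    where
    section-inverse : IsIso r → s ∘ r ≈ id
    section-inverse (r⁻¹ , r⁻¹r≈id , _) = begin
      s ∘ r                 ≈⟨ identityˡ ⟨
      id ∘ (s ∘ r)          ≈⟨ r⁻¹r≈id ⟩∘⟨refl ⟨
      (r⁻¹ ∘ r) ∘ (s ∘ r)   ≈⟨ assoc ⟩
      r⁻¹ ∘ (r ∘ (s ∘ r))   ≈⟨ refl⟩∘⟨ cancelˡ rs≈id ⟩
      r⁻¹ ∘ r               ≈⟨ r⁻¹r≈id ⟩
      id                    ∎

module MonadProperties {o ℓ e} (C : Category o ℓ e) (T : Monad C) where
  open Category C
  open Monad T
  open CategoryProperties C

  η-mono : ∀ X → Mono (η (F₀ X))
  η-mono X = split-mono (μ X) (η (F₀ X)) μ-identityʳ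

  Thunkable : ∀ {A B} → Hom A (F₀ B) → Set e
  Thunkable {B = B} f = η (F₀ B) ∘ f ≈ F₁ (η B) ∘ f

  F₁∘-thunkable : ∀ {A B Z} (f : Hom B Z) {g : Hom A (F₀ B)} → Thunkable g → Thunkable (F₁ f ∘ g)
  F₁∘-thunkable {B = B} {Z} f {g} g-thunkable = begin
    η (F₀ Z) ∘ (F₁ f ∘ g)        ≈⟨ sym-assoc ⟩
    (η (F₀ Z) ∘ F₁ f) ∘ g        ≈⟨ η-natural (F₁ f) ⟩∘⟨refl ⟨
    (F₁ (F₁ f) ∘ η (F₀ B)) ∘ g   ≈⟨ assoc ⟩
    F₁ (F₁ f) ∘ (η (F₀ B) ∘ g)   ≈⟨ refl⟩∘⟨ g-thunkable ⟩
    F₁ (F₁ f) ∘ (F₁ (η B) ∘ g)   ≈⟨ sym-assoc ⟩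
    (F₁ (F₁ f) ∘ F₁ (η B)) ∘ g   ≈⟨ F-∘ ⟩∘⟨refl ⟨
    F₁ (F₁ f ∘ η B) ∘ g          ≈⟨ F-resp-≈ (η-natural f) ⟩∘⟨refl ⟩
    F₁ (η Z ∘ f) ∘ g             ≈⟨ F-∘ ⟩∘⟨refl ⟩
    (F₁ (η Z) ∘ F₁ f) ∘ g        ≈⟨ assoc ⟩
    F₁ (η Z) ∘ (F₁ f ∘ g)        ∎

module ThunkableMonadProperties {o ℓ e} (C : Category o ℓ e) (T : Monad C)
    (eq : ∀ X → Category.Equalizer C (Monad.η T (Monad.F₀ T X)) (Monad.F₁ T (Monad.η T X))) where
  open Category C
  open Monad T
  open Thunk C T eq
  open CategoryProperties C
  open MonadProperties C T

  θ-mono : ∀ X → Mono (θ X)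
  θ-mono X = equalizer-mono (E.isEqualizer X)

  eD : ∀ X → Hom X (D₀ X)
  eD X = E.factor X (η X) (≈-sym (η-natural (η X)))

  θ∘eD≈η : ∀ X → θ X ∘ eD X ≈ η X
  θ∘eD≈η X = E.factor-eq X (η X) (≈-sym (η-natural (η X)))

  θ∘μD≈μ∘Tθ∘θ : ∀ X → θ X ∘ μD X ≈ μ X ∘ F₁ (θ X) ∘ θ (D₀ X)
  θ∘μD≈μ∘Tθ∘θ X = E.factor-eq X _ _

  μD-identityʳ : ∀ X → μD X ∘ eD (D₀ X) ≈ id
  μD-identityʳ X = θ-mono X _ _ (begin
    θ X ∘ (μD X ∘ eD (D₀ X))                    ≈⟨ sym-assoc ⟩
    (θ X ∘ μD X) ∘ eD (D₀ X)                    ≈⟨ θ∘μD≈μ∘Tθ∘θ X ⟩∘⟨refl ⟩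
    (μ X ∘ F₁ (θ X) ∘ θ (D₀ X)) ∘ eD (D₀ X)     ≈⟨ ≈-trans assoc (refl⟩∘⟨ assoc) ⟩
    μ X ∘ F₁ (θ X) ∘ (θ (D₀ X) ∘ eD (D₀ X))     ≈⟨ refl⟩∘⟨ refl⟩∘⟨ θ∘eD≈η (D₀ X) ⟩
    μ X ∘ F₁ (θ X) ∘ η (D₀ X)                   ≈⟨ refl⟩∘⟨ η-natural (θ X) ⟩
    μ X ∘ η (F₀ X) ∘ θ X                        ≈⟨ cancelˡ μ-identityʳ ⟩
    θ X                                         ≈⟨ identityʳ ⟨
    θ X ∘ id                                    ∎)

  μD-iso⇔θ≈η∘μD : ∀ X → IsIso (μD X) ⇔ (θ (D₀ X) ≈ η (D₀ X) ∘ μD X)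
  μD-iso⇔θ≈η∘μD X = mk⇔ (θ≈η∘μD ∘′ to) (from ∘′ eD∘μD≈id)
    where
    open Equivalence (retraction-iso⇔section-inverse (μD-identityʳ X))
    DX : Obj
    DX = D₀ X
    θ≈η∘μD : eD DX ∘ μD X ≈ id → θ DX ≈ η DX ∘ μD X
    θ≈η∘μD eμ≈id = begin
      θ DX                    ≈⟨ identityʳ ⟨
      θ DX ∘ id               ≈⟨ refl⟩∘⟨ eμ≈id ⟨
      θ DX ∘ (eD DX ∘ μD X)   ≈⟨ sym-assoc ⟩
      (θ DX ∘ eD DX) ∘ μD X   ≈⟨ θ∘eD≈η DX ⟩∘⟨refl ⟩
      η DX ∘ μD X             ∎
    eD∘μD≈id : θ DX ≈ η DX ∘ μD X → eD DX ∘ μD X ≈ id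
    eD∘μD≈id θ≈ημ = θ-mono DX _ _ (begin
      θ DX ∘ (eD DX ∘ μD X)   ≈⟨ sym-assoc ⟩
      (θ DX ∘ eD DX) ∘ μD X   ≈⟨ θ∘eD≈η DX ⟩∘⟨refl ⟩
      η DX ∘ μD X             ≈⟨ θ≈ημ ⟨
      θ DX                    ≈⟨ identityʳ ⟨
      θ DX ∘ id               ∎)

  Tθ-mono⇒θ≈η∘μD : ∀ X → Mono (F₁ (θ X)) → θ (D₀ X) ≈ η (D₀ X) ∘ μD X
  Tθ-mono⇒θ≈η∘μD X Tθ-mono = Tθ-mono _ _ (begin
    F₁ (θ X) ∘ θ DX                     ≈⟨ kleisli-thunkableˡ (θ DX) (θ X) (E.equality DX) ⟨
    η (F₀ X) ∘ (μ X ∘ F₁ (θ X) ∘ θ DX)  ≈⟨ refl⟩∘⟨ θ∘μD≈μ∘Tθ∘θ X ⟨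
    η (F₀ X) ∘ (θ X ∘ μD X)             ≈⟨ sym-assoc ⟩
    (η (F₀ X) ∘ θ X) ∘ μD X             ≈⟨ η-natural (θ X) ⟩∘⟨refl ⟨
    (F₁ (θ X) ∘ η DX) ∘ μD X            ≈⟨ assoc ⟩
    F₁ (θ X) ∘ (η DX ∘ μD X)            ∎)
    where
    DX : Obj
    DX = D₀ X

  θ≈η∘μD⇒Tθ-retraction : ∀ X → θ (D₀ X) ≈ η (D₀ X) ∘ μD X →
                         (μ (D₀ X) ∘ F₁ (F₁ (eD X))) ∘ F₁ (θ X) ≈ id
  θ≈η∘μD⇒Tθ-retraction X θ≈ημ = begin
    (μ DX ∘ F₁ (F₁ (eD X))) ∘ F₁ (θ X)  ≈⟨ assoc ⟩
    μ DX ∘ (F₁ (F₁ (eD X)) ∘ F₁ (θ X))  ≈⟨ refl⟩∘⟨ F-∘ ⟨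
    μ DX ∘ F₁ k                         ≈⟨ refl⟩∘⟨ F-resp-≈ k≈η ⟩
    μ DX ∘ F₁ (η DX)                    ≈⟨ μ-identityˡ ⟩
    id                                  ∎
    where
    DX : Obj
    DX = D₀ X
    k : Hom DX (F₀ DX)
    k = F₁ (eD X) ∘ θ X
    k-thunkable : Thunkable k
    k-thunkable = F₁∘-thunkable (eD X) (E.equality X)
    -- k factors through θ_{DX}, which is pure, so k is pure: k = η_{DX} ∘ w.
    w : Hom DX DX
    w = μD X ∘ E.factor DX k k-thunkable
    k≈η∘w : k ≈ η DX ∘ w
    k≈η∘w = begin
      k                                           ≈⟨ E.factor-eq DX k k-thunkable ⟨
      θ DX ∘ E.factor DX k k-thunkable            ≈⟨ θ≈ημ ⟩∘⟨refl ⟩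
      (η DX ∘ μD X) ∘ E.factor DX k k-thunkable   ≈⟨ assoc ⟩
      η DX ∘ w                                    ∎
    w≈id : w ≈ id
    w≈id = θ-mono X _ _ (η-mono X _ _ (begin
      η (F₀ X) ∘ (θ X ∘ w)          ≈⟨ sym-assoc ⟩
      (η (F₀ X) ∘ θ X) ∘ w          ≈⟨ η-natural (θ X) ⟩∘⟨refl ⟨
      (F₁ (θ X) ∘ η DX) ∘ w         ≈⟨ assoc ⟩
      F₁ (θ X) ∘ (η DX ∘ w)         ≈⟨ refl⟩∘⟨ k≈η∘w ⟨
      F₁ (θ X) ∘ k                  ≈⟨ sym-assoc ⟩
      (F₁ (θ X) ∘ F₁ (eD X)) ∘ θ X  ≈⟨ F-∘ ⟩∘⟨refl ⟨
      F₁ (θ X ∘ eD X) ∘ θ X         ≈⟨ F-resp-≈ (θ∘eD≈η X) ⟩∘⟨refl ⟩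
      F₁ (η X) ∘ θ X                ≈⟨ E.equality X ⟨
      η (F₀ X) ∘ θ X                ≈⟨ refl⟩∘⟨ identityʳ ⟨
      η (F₀ X) ∘ (θ X ∘ id)         ∎))
    k≈η : k ≈ η DX
    k≈η = ≈-trans k≈η∘w (≈-trans (refl⟩∘⟨ w≈id) identityʳ)

  μD-iso⇔Tθ-mono : ∀ X → IsIso (μD X) ⇔ Mono (F₁ (θ X))
  μD-iso⇔Tθ-mono X = mk⇔ Tθ-mono (from ∘′ Tθ-mono⇒θ≈η∘μD X)
    where
    open Equivalence (μD-iso⇔θ≈η∘μD X)
    Tθ-mono : IsIso (μD X) → Mono (F₁ (θ X))
    Tθ-mono μD-iso = split-mono _ _ (θ≈η∘μD⇒Tθ-retraction X (to μD-iso))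

  idempotent⇔Tθ-mono : Idempotent ⇔ (∀ X → Mono (F₁ (θ X)))
  idempotent⇔Tθ-mono = mk⇔ idempotent⇒Tθ-mono Tθ-mono⇒idempotent
    where
    open Equivalence
    idempotent⇒Tθ-mono : Idempotent → ∀ X → Mono (F₁ (θ X))
    idempotent⇒Tθ-mono idem X = to (μD-iso⇔Tθ-mono X) (idem X)
    Tθ-mono⇒idempotent : (∀ X → Mono (F₁ (θ X))) → Idempotent
    Tθ-mono⇒idempotent Tθ-mono X = from (μD-iso⇔Tθ-mono X) (Tθ-mono X)

  θ-regular-mono : ∀ X → RegularMono (θ X)
  θ-regular-mono X = _ , _ , _ , E.isEqualizer X

lemma5p7 : ∀ {o ℓ e} (C : Category o ℓ e) (T : Monad C)
           (eq : ∀ X → Category.Equalizer C (Monad.η T (Monad.F₀ T X)) (Monad.F₁ T (Monad.η T X))) →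
           let open Category C
               open Monad T
               open Thunk C T eq
           in (Idempotent ⇔ (∀ X → Mono (F₁ (θ X))))
              × ((∀ {A B} (m : Hom A B) → RegularMono m → Mono (F₁ m)) → Idempotent)
lemma5p7 C T eq = idempotent⇔Tθ-mono , λ T-preserves →
    Equivalence.from idempotent⇔Tθ-mono (λ X → T-preserves (θ X) (θ-regular-mono X))
  where
  open Thunk C T eq
  open ThunkableMonadProperties C T eq
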